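{- Let $t\geq 0$ be an integer and let $H$ be a graph in which every edge has multiplicity exactly $t+1$. For every subgraph $K\subseteq H$ with $E(K)\neq\emptyset$, let $Z(K)=\{v\in V(K): d_K(v)=d_H(v)\}$. Then the following are equivalent: (i) $\operatorname{cfan}(H)\leq t$; (ii) for every subgraph $K\subseteq H$ with $E(K)\neq\emptyset$ that has full multiplicity, there is an edge $xy\in E(K)$ such that $|(N_H(x)\cap Z(K))\setminus\{y\}|\leq d_H(y)-d_K(y)$.
   Context: A graph may have parallel edges but no loops. For a graph $J$, $\mu_J(x,y)$ is the number of edges of $J$ joining $x$ and $y$; $d_J(v)$ is the degree of $v$ counting parallel edges; $N_J(x)$ is the neighbourhood of $x$. A subgraph may contain only some of the parallel copies of an edge. A subgraph $K\subseteq H$ has full multiplicity if $\mu_K(e)=\mu_H(e)$ for every $e\in E(K)$. For a subgraph $K\subseteq H$ and an ordered pair $(x,y)$ with $xy\in E(K)$, $\operatorname{cdeg}_{H,K}(x,y)$ is the smallest nonnegative integer $l$ such that for all $Z\subseteq N_K(x)$ with $y\in Z$, $\sum_{z\in Z}(d_K(z)-d_H(z)+\mu_K(x,z)-l)\leq 1$; $\operatorname{cfan}(H)=\max_{K\subseteq H,\,E(K)\neq\emptyset}\min\{\operatorname{cdeg}_{H,K}(x,y): xy\in E(K)\}$, with $\operatorname{cfan}(H)=0$ if $H$ is edgeless. -}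

module Defs where

open import Data.Nat using (ℕ; zero; suc; _+_; _∸_; _≤_; _<_)
open import Data.Nat as ℕ using ()
open import Data.Integer as ℤ using (ℤ; +_)
open import Data.Fin using (Fin; zero; suc)
open import Data.Fin as Fin using ()
open import Data.Bool using (Bool; true; false; if_then_else_; _∧_; not)
open import Data.Product using (Σ; _×_; ∃; ∃-syntax; _,_)
open import Relation.Nullary using (¬_)
open import Relation.Nullary.Decidable using (⌊_⌋)
open import Relation.Binary.PropositionalEquality using (_≡_)

sumℕ : ∀ {n} → (Fin n → ℕ) → ℕ
sumℕ {zero}  f = 0
sumℕ {suc n} f = f zero + sumℕ (λ i → f (suc i))

sumℤ : ∀ {n} → (Fin n → ℤ) → ℤ
sumℤ {zero}  f = + 0
sumℤ {suc n} f = f zero ℤ.+ sumℤ (λ i → f (suc i))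

record Graph (n : ℕ) : Set where
  field
    μ        : Fin n → Fin n → ℕ
    sym      : ∀ x y → μ x y ≡ μ y x
    loopless : ∀ x → μ x x ≡ 0
open Graph public

Edge : ∀ {n} → Graph n → Fin n → Fin n → Set
Edge J x y = 0 < μ J x y

HasEdge : ∀ {n} → Graph n → Set
HasEdge J = ∃[ x ] ∃[ y ] Edge J x y

deg : ∀ {n} → Graph n → Fin n → ℕ
deg J v = sumℕ (λ u → μ J v u)

-- K ⊆ H (K may contain only some of the parallel copies of an edge)
_⊆G_ : ∀ {n} → Graph n → Graph n → Set
K ⊆G H = ∀ x y → μ K x y ≤ μ H x y

FullMult : ∀ {n} → Graph n → Graph n → Set
FullMult H K = ∀ x y → Edge K x y → μ K x y ≡ μ H x y

CdegCond : ∀ {n} → Graph n → Graph n → Fin n → Fin n → ℕ → Set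
CdegCond {n} H K x y l =
  (Z : Fin n → Bool) →
  (∀ z → Z z ≡ true → Edge K x z) →
  Z y ≡ true →
  sumℤ (λ z → if Z z
                then (+ deg K z) ℤ.- (+ deg H z) ℤ.+ (+ μ K x z) ℤ.- (+ l)
                else + 0)
    ℤ.≤ + 1

IsCdeg : ∀ {n} → Graph n → Graph n → Fin n → Fin n → ℕ → Set
IsCdeg H K x y l = CdegCond H K x y l × (∀ l' → l' < l → ¬ CdegCond H K x y l')

-- cfan(H) ≤ t, unfolded: cfan(H) is the max over subgraphs K with E(K) ≠ ∅
-- of min_{xy ∈ E(K)} cdeg_{H,K}(x,y) (and 0 if H is edgeless), so
-- cfan(H) ≤ t iff every such K has an edge xy with cdeg_{H,K}(x,y) ≤ t.
CfanLe : ∀ {n} → Graph n → ℕ → Set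
CfanLe {n} H t =
  (K : Graph n) → K ⊆G H → HasEdge K →
  ∃[ x ] ∃[ y ] (Edge K x y × ∃[ l ] (IsCdeg H K x y l × l ≤ t))

countNZ : ∀ {n} → Graph n → Graph n → Fin n → Fin n → ℕ
countNZ H K x y =
  sumℕ (λ v → if ⌊ 0 ℕ.<? μ H x v ⌋ ∧ ⌊ deg K v ℕ.≟ deg H v ⌋ ∧ not ⌊ v Fin.≟ y ⌋
              then 1 else 0)

-- Write s(z) = d_K(z) − d_H(z) + μ_K(x,z) − l for the summands in cdeg_{H,K}(x,y). When every
-- edge of H has multiplicity t + 1, a vertex z ∈ N_H(x) ∩ Z(K) has s(z) = t + 1 − l ≥ 1, so the
-- set Z = {y} ∪ (N_H(x) ∩ Z(K)) turns cdeg_{H,K}(x,y) ≤ t into the bound of (ii). Conversely,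
-- for l = t every z ≠ y in N_K(x) has s(z) ≤ 1, and s(z) ≤ 0 unless z ∈ Z(K̄), where K̄ is the
-- full-multiplicity subgraph with the edges of K; so the edge given by (ii) for K̄ satisfies the
-- cdeg condition at t, and the least l satisfying it can be found because it is decidable.

module Submission where

open import Defs
open import Data.Nat using (ℕ; suc; _∸_; _≤_)
open import Data.Fin using (Fin)
open import Data.Sum using (_⊎_)
open import Data.Product using (_×_; ∃-syntax)
open import Function.Bundles using (_⇔_)
open import Relation.Binary.PropositionalEquality using (_≡_)

open import Data.Bool using (Bool; true; false; if_then_else_; _∧_; _∨_; not)
import Data.Bool.Properties as Bool
open import Data.Empty using (⊥-elim)
open import Data.Fin as Fin using (zero; suc)
import Data.Fin.Properties as Fin
open import Data.Fin.Subset.Properties using (anySubset?)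
open import Data.Integer as ℤ using (ℤ; +_; +≤+; _⊖_)
import Data.Integer.Properties as ℤ
open import Data.Integer.Tactic.RingSolver using (solve-∀)
open import Data.Nat as ℕ using (zero; _+_; _<_; z≤n; s≤s; s≤s⁻¹)
open import Data.Nat.Properties as ℕ using (module ≤-Reasoning)
open import Data.Product using (_,_)
open import Data.Sum using (inj₁; inj₂)
open import Data.Vec using (lookup; tabulate)
open import Data.Vec.Properties using (lookup∘tabulate)
open import Function.Base using (_∘_; case_of_)
open import Function.Bundles using (mk⇔)
open import Relation.Binary.PropositionalEquality as ≡
  using (refl; trans; cong; cong₂; subst; _≗_)
open import Relation.Nullary using (¬_; Dec; yes; no; ¬?)
open import Relation.Nullary.Decidable using (⌊_⌋; _→-dec_; decidable-stable)
open import Relation.Unary using (Decidable)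

import Algebra.Properties.CommutativeSemigroup ℤ.+-commutativeSemigroup as ℤ+
open import Algebra.Properties.CommutativeSemigroup ℕ.+-commutativeSemigroup
  using (xy∙z≈xz∙y; xy∙z≈yz∙x)

m+n⊖n≡m : ∀ m n → (m + n) ⊖ n ≡ + m
m+n⊖n≡m m n = trans (ℤ.≤-⊖ (ℕ.m≤n+m n m)) (cong +_ (ℕ.m+n∸n≡m m n))

m≤o+n⇒m⊖n≤o : ∀ {m n o} → m ≤ o + n → m ⊖ n ℤ.≤ + o
m≤o+n⇒m⊖n≤o {n = n} {o} m≤o+n =
  ℤ.≤-trans (ℤ.⊖-monoˡ-≤ n m≤o+n) (ℤ.≤-reflexive (m+n⊖n≡m o n))

o+n≤m⇒o≤m⊖n : ∀ {m n o} → o + n ≤ m → + o ℤ.≤ m ⊖ n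
o+n≤m⇒o≤m⊖n {n = n} {o} o+n≤m =
  ℤ.≤-trans (ℤ.≤-reflexive (≡.sym (m+n⊖n≡m o n))) (ℤ.⊖-monoˡ-≤ n o+n≤m)

m⊖n≤o⇒m≤o+n : ∀ {m n o} → m ⊖ n ℤ.≤ + o → m ≤ o + n
m⊖n≤o⇒m≤o+n m⊖n≤o =
  ℕ.≮⇒≥ λ o+n<m → ℤ.<⇒≱ (ℤ.+<+ ℕ.≤-refl) (ℤ.≤-trans (o+n≤m⇒o≤m⊖n o+n<m) m⊖n≤o)

balance : ℕ → ℕ → ℕ → ℕ → ℤ
balance a b m l = + a ℤ.- + b ℤ.+ + m ℤ.- + l

balance≡⊖ : ∀ a b m l → balance a b m l ≡ (a + m) ⊖ (b + l)
balance≡⊖ a b m l = begin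
  + a ℤ.- + b ℤ.+ + m ℤ.- + l     ≡⟨ regroup (+ a) (+ b) (+ m) (+ l) ⟩
  (+ a ℤ.+ + m) ℤ.- (+ b ℤ.+ + l) ≡⟨ cong₂ ℤ._-_ (≡.sym (ℤ.pos-+ a m)) (≡.sym (ℤ.pos-+ b l)) ⟩
  + (a + m) ℤ.- + (b + l)         ≡⟨ ℤ.[+m]-[+n]≡m⊖n (a + m) (b + l) ⟩
  (a + m) ⊖ (b + l)               ∎
  where
  open ≡.≡-Reasoning
  regroup : ∀ a b m l → a ℤ.- b ℤ.+ m ℤ.- l ≡ (a ℤ.+ m) ℤ.- (b ℤ.+ l)
  regroup = solve-∀

balance-+ : ∀ a b m l c → balance a b m l ℤ.+ + c ≡ (a + m + c) ⊖ (b + l)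
balance-+ a b m l c =
  trans (cong (ℤ._+ + c) (balance≡⊖ a b m l)) (ℤ.distribˡ-⊖-+-pos c (a + m) (b + l))

balance≥1 : ∀ {a b m t l} → a ≡ b → m ≡ suc t → l ≤ t → + 1 ℤ.≤ balance a b m l
balance≥1 {a} {t = t} {l} refl refl l≤t =
  subst (+ 1 ℤ.≤_) (≡.sym (balance≡⊖ a a (suc t) l)) (o+n≤m⇒o≤m⊖n (begin
    suc (a + l) ≡⟨ ℕ.+-suc a l ⟨
    a + suc l   ≤⟨ ℕ.+-monoʳ-≤ a (s≤s l≤t) ⟩
    a + suc t   ∎))
  where open ≤-Reasoning

balance≤0 : ∀ {a b m t} → a < b → m ≤ suc t → balance a b m t ℤ.≤ + 0
balance≤0 {a} {b} {m} {t} a<b m≤1+t =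
  subst (ℤ._≤ + 0) (≡.sym (balance≡⊖ a b m t)) (m≤o+n⇒m⊖n≤o (begin
    a + m     ≤⟨ ℕ.+-monoʳ-≤ a m≤1+t ⟩
    a + suc t ≡⟨ ℕ.+-suc a t ⟩
    suc a + t ≤⟨ ℕ.+-monoˡ-≤ t a<b ⟩
    b + t     ∎))
  where open ≤-Reasoning

balance+≤1 : ∀ {a b m t c} → a ≤ b → m ≤ suc t → c ≤ b ∸ a → balance a b m t ℤ.+ + c ℤ.≤ + 1
balance+≤1 {a} {b} {m} {t} {c} a≤b m≤1+t c≤b∸a =
  subst (ℤ._≤ + 1) (≡.sym (balance-+ a b m t c)) (m≤o+n⇒m⊖n≤o (begin
    a + m + c           ≤⟨ ℕ.+-mono-≤ (ℕ.+-monoʳ-≤ a m≤1+t) c≤b∸a ⟩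
    a + suc t + (b ∸ a) ≡⟨ xy∙z≈xz∙y a (suc t) (b ∸ a) ⟩
    a + (b ∸ a) + suc t ≡⟨ cong (_+ suc t) (ℕ.m+[n∸m]≡n a≤b) ⟩
    b + suc t           ≡⟨ ℕ.+-suc b t ⟩
    suc (b + t)         ∎))
  where open ≤-Reasoning

balance≤1 : ∀ {a b m t} → a ≤ b → m ≤ suc t → balance a b m t ℤ.≤ + 1
balance≤1 {a} {b} {m} {t} a≤b m≤1+t =
  subst (ℤ._≤ + 1) (ℤ.+-identityʳ (balance a b m t)) (balance+≤1 a≤b m≤1+t z≤n)

balance+≤1⇒≤∸ : ∀ {a b m t l c} → m ≡ suc t → balance a b m l ℤ.+ + c ℤ.≤ + 1 → l ≤ t →
                c ≤ b ∸ a
balance+≤1⇒≤∸ {a} {b} {t = t} {l} {c} refl ≤1 l≤t =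
  ℕ.m+n≤o⇒m≤o∸n c (ℕ.+-cancelʳ-≤ (suc t) (c + a) b (begin
    c + a + suc t ≡⟨ xy∙z≈yz∙x c a (suc t) ⟩
    a + suc t + c ≤⟨ m⊖n≤o⇒m≤o+n (subst (ℤ._≤ + 1) (balance-+ a b (suc t) l c) ≤1) ⟩
    suc (b + l)   ≤⟨ s≤s (ℕ.+-monoʳ-≤ b l≤t) ⟩
    suc (b + t)   ≡⟨ ℕ.+-suc b t ⟨
    b + suc t     ∎))
  where open ≤-Reasoning

sumℕ-mono-≤ : ∀ {n} {f g : Fin n → ℕ} → (∀ i → f i ≤ g i) → sumℕ f ≤ sumℕ g
sumℕ-mono-≤ {zero}  f≤g = z≤n
sumℕ-mono-≤ {suc n} f≤g = ℕ.+-mono-≤ (f≤g zero) (sumℕ-mono-≤ (f≤g ∘ suc))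

sumℕ-≤-≡⇒≗ : ∀ {n} {f g : Fin n → ℕ} → (∀ i → f i ≤ g i) → sumℕ f ≡ sumℕ g → f ≗ g
sumℕ-≤-≡⇒≗ {suc n} {f} {g} f≤g sum≡ = λ where
    zero    → head≡
    (suc i) → sumℕ-≤-≡⇒≗ (f≤g ∘ suc) tail≡ i
  where
  head≡ : f zero ≡ g zero
  head≡ = ℕ.≤-antisym (f≤g zero) (ℕ.≮⇒≥ λ f₀<g₀ →
    ℕ.<-irrefl sum≡ (ℕ.+-mono-<-≤ f₀<g₀ (sumℕ-mono-≤ (f≤g ∘ suc))))
  tail≡ : sumℕ (f ∘ suc) ≡ sumℕ (g ∘ suc)
  tail≡ = ℕ.+-cancelˡ-≡ (f zero) _ _ (trans sum≡ (cong (_+ _) (≡.sym head≡)))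

sumℤ-cong : ∀ {n} {f g : Fin n → ℤ} → f ≗ g → sumℤ f ≡ sumℤ g
sumℤ-cong {zero}  f≗g = refl
sumℤ-cong {suc n} f≗g = cong₂ ℤ._+_ (f≗g zero) (sumℤ-cong (f≗g ∘ suc))

sumℤ-mono-≤ : ∀ {n} {f g : Fin n → ℤ} → (∀ i → f i ℤ.≤ g i) → sumℤ f ℤ.≤ sumℤ g
sumℤ-mono-≤ {zero}  f≤g = ℤ.≤-refl
sumℤ-mono-≤ {suc n} f≤g = ℤ.+-mono-≤ (f≤g zero) (sumℤ-mono-≤ (f≤g ∘ suc))

sumℤ-+ : ∀ {n} (f g : Fin n → ℤ) → sumℤ (λ i → f i ℤ.+ g i) ≡ sumℤ f ℤ.+ sumℤ g
sumℤ-+ {zero}  f g = refl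
sumℤ-+ {suc n} f g =
  trans (cong (λ s → f zero ℤ.+ g zero ℤ.+ s) (sumℤ-+ (f ∘ suc) (g ∘ suc)))
        (ℤ+.interchange (f zero) (g zero) (sumℤ (f ∘ suc)) (sumℤ (g ∘ suc)))

sumℤ-pos : ∀ {n} (f : Fin n → ℕ) → sumℤ (λ i → + f i) ≡ + sumℕ f
sumℤ-pos {zero}  f = refl
sumℤ-pos {suc n} f =
  trans (cong (λ s → + f zero ℤ.+ s) (sumℤ-pos (f ∘ suc))) (≡.sym (ℤ.pos-+ (f zero) _))

single : ∀ {n} → Fin n → ℤ → Fin n → ℤ
single y c z = if ⌊ z Fin.≟ y ⌋ then c else + 0

sumℤ-single : ∀ {n} (y : Fin n) c → sumℤ (single y c) ≡ c
sumℤ-single {suc n} zero    c = trans (cong (λ s → c ℤ.+ s) (sumℤ-zero n)) (ℤ.+-identityʳ c)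
  where
  sumℤ-zero : ∀ n → sumℤ {n} (λ _ → + 0) ≡ + 0
  sumℤ-zero zero    = refl
  sumℤ-zero (suc n) = cong (λ s → + 0 ℤ.+ s) (sumℤ-zero n)
sumℤ-single {suc n} (suc y) c =
  trans (ℤ.+-identityˡ _) (trans (sumℤ-cong shift) (sumℤ-single y c))
  where
  shift : ∀ i → single (suc y) c (suc i) ≡ single y c i
  shift i with i Fin.≟ y
  ... | yes _ = refl
  ... | no  _ = refl

sumℤ-single-+ : ∀ {n} (y : Fin n) c (g : Fin n → ℕ) →
                sumℤ (λ z → single y c z ℤ.+ + g z) ≡ c ℤ.+ + sumℕ g
sumℤ-single-+ y c g =
  trans (sumℤ-+ (single y c) (λ z → + g z)) (cong₂ ℤ._+_ (sumℤ-single y c) (sumℤ-pos g))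

module _ {n : ℕ} where

  ⊆G-edge : {K H : Graph n} → K ⊆G H → ∀ {x y} → Edge K x y → Edge H x y
  ⊆G-edge K⊆H {x} {y} xy = ℕ.≤-trans xy (K⊆H x y)

  deg-mono : {K H : Graph n} → K ⊆G H → ∀ z → deg K z ≤ deg H z
  deg-mono K⊆H z = sumℕ-mono-≤ (K⊆H z)

  deg≡⇒μ≡ : {K H : Graph n} → K ⊆G H → ∀ {z} → deg K z ≡ deg H z → ∀ x → μ K x z ≡ μ H x z
  deg≡⇒μ≡ {K} {H} K⊆H {z} deg≡ x =
    trans (Graph.sym K x z) (trans (sumℕ-≤-≡⇒≗ (K⊆H z) deg≡ x) (Graph.sym H z x))

  UniformMultiplicity : Graph n → ℕ → Set
  UniformMultiplicity H m = ∀ x y → μ H x y ≡ 0 ⊎ μ H x y ≡ m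

  uniform-μ≤ : ∀ {H m} → UniformMultiplicity H m → ∀ x y → μ H x y ≤ m
  uniform-μ≤ uniform x y with uniform x y
  ... | inj₁ μ≡0 = ℕ.≤-trans (ℕ.≤-reflexive μ≡0) z≤n
  ... | inj₂ μ≡m = ℕ.≤-reflexive μ≡m

  uniform-edge : ∀ {H m} → UniformMultiplicity H m → ∀ {x y} → Edge H x y → μ H x y ≡ m
  uniform-edge uniform {x} {y} xy with uniform x y
  ... | inj₁ μ≡0 = ⊥-elim (ℕ.<-irrefl (≡.sym μ≡0) xy)
  ... | inj₂ μ≡m = μ≡m

  fillEdges : Graph n → Graph n → Graph n
  fillEdges H K = record { μ = μ′ ; sym = sym′ ; loopless = loopless′ }
    where
    μ′ : Fin n → Fin n → ℕ
    μ′ x y = if ⌊ 0 ℕ.<? μ K x y ⌋ then μ H x y else 0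
    sym′ : ∀ x y → μ′ x y ≡ μ′ y x
    sym′ x y rewrite Graph.sym K x y | Graph.sym H x y = refl
    loopless′ : ∀ x → μ′ x x ≡ 0
    loopless′ x rewrite Graph.loopless K x = refl

  module _ (H K : Graph n) where

    fillEdges-⊆ : fillEdges H K ⊆G H
    fillEdges-⊆ x y with 0 ℕ.<? μ K x y
    ... | yes _ = ℕ.≤-refl
    ... | no  _ = z≤n

    ⊆-fillEdges : K ⊆G H → K ⊆G fillEdges H K
    ⊆-fillEdges K⊆H x y with 0 ℕ.<? μ K x y
    ... | yes _  = K⊆H x y
    ... | no  ¬e = ℕ.≮⇒≥ ¬e

    fillEdges-edge⁻ : ∀ {x y} → Edge (fillEdges H K) x y → Edge K x y
    fillEdges-edge⁻ {x} {y} xy with 0 ℕ.<? μ K x y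
    ... | yes e = e
    ... | no  _ = ⊥-elim (ℕ.<-irrefl refl xy)

    fillEdges-full : FullMult H (fillEdges H K)
    fillEdges-full x y xy with 0 ℕ.<? μ K x y
    ... | yes _ = refl
    ... | no  _ = ⊥-elim (ℕ.<-irrefl refl xy)

allSubsets? : ∀ {n p} {Q : (Fin n → Bool) → Set p} →
              (∀ {Z Z′} → Z ≗ Z′ → Q Z → Q Z′) → (∀ Z → Dec (Q Z)) → Dec (∀ Z → Q Z)
allSubsets? resp Q? with anySubset? (λ p → ¬? (Q? (lookup p)))
... | yes (p , ¬q) = no λ ∀Q → ¬q (∀Q (lookup p))
... | no  ∄¬q      = yes λ Z → resp (lookup∘tabulate Z)
                       (decidable-stable (Q? _) λ ¬q → ∄¬q (tabulate Z , ¬q))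

Least : ∀ {p} → (ℕ → Set p) → ℕ → Set p
Least P l = P l × (∀ l′ → l′ < l → ¬ P l′)

least-witness : ∀ {p} {P : ℕ → Set p} → Decidable P → ∀ {t} → P t → ∃[ l ] (Least P l × l ≤ t)
least-witness {P = P} P? {t} pt with search t
  where
  search : ∀ t → (∀ l → l ≤ t → ¬ P l) ⊎ ∃[ l ] (Least P l × l ≤ t)
  search zero with P? 0
  ... | yes p₀ = inj₂ (0 , (p₀ , λ _ ()) , z≤n)
  ... | no ¬p₀ = inj₁ λ { _ z≤n → ¬p₀ }
  search (suc t) with search t
  ... | inj₂ (l , least , l≤t) = inj₂ (l , least , ℕ.m≤n⇒m≤1+n l≤t)
  ... | inj₁ none with P? (suc t)
  ...   | yes p = inj₂ (suc t , (p , λ l′ l′<1+t → none l′ (s≤s⁻¹ l′<1+t)) , ℕ.≤-refl)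
  ...   | no ¬p = inj₁ λ l l≤1+t → case ℕ.m≤n⇒m<n∨m≡n l≤1+t of λ where
                    (inj₁ l<1+t) → none l (s≤s⁻¹ l<1+t)
                    (inj₂ refl)  → ¬p
... | inj₁ none  = ⊥-elim (none t ℕ.≤-refl pt)
... | inj₂ found = found

charge : ∀ {n} → Graph n → Graph n → Fin n → ℕ → Fin n → ℤ
charge H K x l z = balance (deg K z) (deg H z) (μ K x z) l

restrict : ∀ {n} → (Fin n → Bool) → (Fin n → ℤ) → Fin n → ℤ
restrict Z f z = if Z z then f z else + 0

module _ {n : ℕ} (H K : Graph n) (x y : Fin n) where

  CdegTest : ℕ → (Fin n → Bool) → Set
  CdegTest l Z = (∀ z → Z z ≡ true → Edge K x z) → Z y ≡ true →
                 sumℤ (restrict Z (charge H K x l)) ℤ.≤ + 1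

  cdegCond? : ∀ l → Dec (CdegCond H K x y l)
  cdegCond? l = allSubsets? {Q = CdegTest l} resp test?
    where
    resp : ∀ {Z Z′} → Z ≗ Z′ → CdegTest l Z → CdegTest l Z′
    resp Z≗Z′ test Z′⊆N y∈Z′ =
      subst (ℤ._≤ + 1) (sumℤ-cong λ z → cong (λ b → if b then charge H K x l z else + 0) (Z≗Z′ z))
        (test (λ z z∈Z → Z′⊆N z (trans (≡.sym (Z≗Z′ z)) z∈Z)) (trans (Z≗Z′ y) y∈Z′))
    test? : ∀ Z → Dec (CdegTest l Z)
    test? Z = Fin.all? (λ z → (Z z Bool.≟ true) →-dec (0 ℕ.<? μ K x z))
              →-dec ((Z y Bool.≟ true) →-dec (_ ℤ.≤? + 1))

  cdeg-≤ : ∀ {t} → CdegCond H K x y t → ∃[ l ] (IsCdeg H K x y l × l ≤ t)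
  cdeg-≤ = least-witness cdegCond?

countTerm : ∀ {n} → Graph n → Graph n → Fin n → Fin n → Fin n → ℕ
countTerm H K x y v =
  if ⌊ 0 ℕ.<? μ H x v ⌋ ∧ ⌊ deg K v ℕ.≟ deg H v ⌋ ∧ not ⌊ v Fin.≟ y ⌋ then 1 else 0

module _ {n t : ℕ} (H K : Graph n) (uniform : UniformMultiplicity H (suc t)) (K⊆H : K ⊆G H)
         {x y : Fin n} where

  cdegCond⇒countNZ≤ : μ K x y ≡ suc t → ∀ {l} → CdegCond H K x y l → l ≤ t →
                      countNZ H K x y ≤ deg H y ∸ deg K y
  cdegCond⇒countNZ≤ μxy {l} cond l≤t = balance+≤1⇒≤∸ {deg K y} {deg H y} μxy bound l≤t
    where
    full⇒μ≡ : ∀ {z} → Edge H x z → deg K z ≡ deg H z → μ K x z ≡ suc t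
    full⇒μ≡ xz deg≡ = trans (deg≡⇒μ≡ {K = K} {H = H} K⊆H deg≡ x) (uniform-edge {H = H} uniform xz)

    Z* : Fin n → Bool
    Z* z = ⌊ z Fin.≟ y ⌋ ∨ ⌊ 0 ℕ.<? μ H x z ⌋ ∧ ⌊ deg K z ℕ.≟ deg H z ⌋

    Z*⊆N : ∀ z → Z* z ≡ true → Edge K x z
    Z*⊆N z z∈Z* with z Fin.≟ y | 0 ℕ.<? μ H x z | deg K z ℕ.≟ deg H z
    ... | yes refl | _      | _      = subst (0 <_) (≡.sym μxy) (s≤s z≤n)
    ... | no _     | yes xz | yes eq = subst (0 <_) (≡.sym (full⇒μ≡ xz eq)) (s≤s z≤n)
    ... | no _     | yes _  | no _   = case z∈Z* of λ ()
    ... | no _     | no _   | _      = case z∈Z* of λ ()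

    y∈Z* : Z* y ≡ true
    y∈Z* with y Fin.≟ y
    ... | yes _  = refl
    ... | no y≢y = ⊥-elim (y≢y refl)

    below : ∀ z → single y (charge H K x l y) z ℤ.+ + countTerm H K x y z
                    ℤ.≤ restrict Z* (charge H K x l) z
    below z with z Fin.≟ y | 0 ℕ.<? μ H x z | deg K z ℕ.≟ deg H z
    ... | yes refl | yes _  | yes _  = ℤ.≤-reflexive (ℤ.+-identityʳ _)
    ... | yes refl | yes _  | no _   = ℤ.≤-reflexive (ℤ.+-identityʳ _)
    ... | yes refl | no _   | _      = ℤ.≤-reflexive (ℤ.+-identityʳ _)
    ... | no _     | yes xz | yes eq = balance≥1 eq (full⇒μ≡ xz eq) l≤t
    ... | no _     | yes _  | no _   = ℤ.≤-refl
    ... | no _     | no _   | _      = ℤ.≤-refl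

    bound : charge H K x l y ℤ.+ + countNZ H K x y ℤ.≤ + 1
    bound = subst (ℤ._≤ + 1) (sumℤ-single-+ y _ (countTerm H K x y))
              (ℤ.≤-trans (sumℤ-mono-≤ below) (cond Z* Z*⊆N y∈Z*))

  countNZ≤⇒cdegCond : ∀ K′ → K ⊆G K′ → K′ ⊆G H →
                      countNZ H K′ x y ≤ deg H y ∸ deg K′ y → CdegCond H K x y t
  countNZ≤⇒cdegCond K′ K⊆K′ K′⊆H count≤ Z Z⊆N y∈Z =
    ℤ.≤-trans (sumℤ-mono-≤ above)
      (subst (ℤ._≤ + 1) (≡.sym (sumℤ-single-+ y _ (countTerm H K′ x y))) bound)
    where
    degK≤degK′ : ∀ z → deg K z ≤ deg K′ z
    degK≤degK′ = deg-mono {K = K} {H = K′} K⊆K′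

    degK≤degH : ∀ z → deg K z ≤ deg H z
    degK≤degH = deg-mono {K = K} {H = H} K⊆H

    μ≤ : ∀ z → μ K x z ≤ suc t
    μ≤ z = ℕ.≤-trans (K⊆H x z) (uniform-μ≤ {H = H} uniform x z)

    above : ∀ z → restrict Z (charge H K x t) z
                    ℤ.≤ single y (charge H K x t y) z ℤ.+ + countTerm H K′ x y z
    above z with Z z in z∈Z | z Fin.≟ y | 0 ℕ.<? μ H x z | deg K′ z ℕ.≟ deg H z
    ... | false | yes refl | _     | _     = case trans (≡.sym z∈Z) y∈Z of λ ()
    ... | false | no _     | _     | _     = +≤+ z≤n
    ... | true  | yes refl | _     | _     = ℤ.i≤i+j _ _
    ... | true  | no _     | no ¬e | _     = ⊥-elim (¬e (⊆G-edge {K = K} {H = H} K⊆H (Z⊆N z z∈Z)))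
    ... | true  | no _     | yes _ | yes _ = balance≤1 (degK≤degH z) (μ≤ z)
    ... | true  | no _     | yes _ | no ≢  = balance≤0 degK<degH (μ≤ z)
      where
      degK<degH : deg K z < deg H z
      degK<degH = ℕ.≤-<-trans (degK≤degK′ z) (ℕ.≤∧≢⇒< (deg-mono {K = K′} {H = H} K′⊆H z) ≢)

    bound : charge H K x t y ℤ.+ + countNZ H K′ x y ℤ.≤ + 1
    bound = balance+≤1 (degK≤degH y) (μ≤ y)
              (ℕ.≤-trans count≤ (ℕ.∸-monoʳ-≤ (deg H y) (degK≤degK′ y)))

FanCondition : ∀ {n} → Graph n → Set
FanCondition {n} H = (K : Graph n) → K ⊆G H → HasEdge K → FullMult H K →
  ∃[ x ] ∃[ y ] (Edge K x y × countNZ H K x y ≤ deg H y ∸ deg K y)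

module _ {n t : ℕ} (H : Graph n) (uniform : UniformMultiplicity H (suc t)) where

  cfan≤⇒fanCondition : CfanLe H t → FanCondition H
  cfan≤⇒fanCondition cfan K K⊆H hasEdge full with cfan K K⊆H hasEdge
  ... | x , y , xy , l , (cond , _) , l≤t =
    x , y , xy , cdegCond⇒countNZ≤ H K uniform K⊆H μxy cond l≤t
    where
    μxy : μ K x y ≡ suc t
    μxy = trans (full x y xy) (uniform-edge {H = H} uniform (⊆G-edge {K = K} {H = H} K⊆H xy))

  fanCondition⇒cfan≤ : FanCondition H → CfanLe H t
  fanCondition⇒cfan≤ fan K K⊆H (x₀ , y₀ , x₀y₀)
    with fan (fillEdges H K) (fillEdges-⊆ H K) (x₀ , y₀ , x₀y₀∈K̄) (fillEdges-full H K)
    where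
    x₀y₀∈K̄ : Edge (fillEdges H K) x₀ y₀
    x₀y₀∈K̄ = ⊆G-edge {K = K} {H = fillEdges H K} (⊆-fillEdges H K K⊆H) x₀y₀
  ... | x , y , xy , count≤ =
    x , y , fillEdges-edge⁻ H K xy , cdeg-≤ H K x y (countNZ≤⇒cdegCond H K uniform K⊆H
      (fillEdges H K) (⊆-fillEdges H K K⊆H) (fillEdges-⊆ H K) count≤)

lemma3p4 : (t n : ℕ) (H : Graph n) →
    (∀ x y → μ H x y ≡ 0 ⊎ μ H x y ≡ suc t) →
    CfanLe H t ⇔
      ((K : Graph n) → K ⊆G H → HasEdge K → FullMult H K →
        ∃[ x ] ∃[ y ] (Edge K x y × countNZ H K x y ≤ deg H y ∸ deg K y))
lemma3p4 t n H uniform = mk⇔ (cfan≤⇒fanCondition H uniform) (fanCondition⇒cfan≤ H uniform)
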